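{- Let $\mathcal{R}$ be the rules of an LCTRS satisfying the standing restrictions below, and let $\mathcal{E}$ be a set of equations. The following are equivalent: (i) all equations in $\mathcal{E}$ are inductive theorems of $\mathcal{R}$; (ii) for all ground terms $s,t$ with $s\leftrightarrow_{\mathcal{E}}t$ we have $s\leftrightarrow^*_{\mathcal{R}}t$.
   Context: LCTRS basics. Terms are well-sorted first-order terms over a many-sorted signature $\Sigma=\Sigma_{terms}\cup\Sigma_{theory}$ and sorted variables; contexts $C[\ ]$ as usual. A substitution is a sort-preserving map on variables, identity almost everywhere; $\mathit{Dom}(\gamma)=\{x\mid\gamma(x)\neq x\}$. Theory sorts (sorts in $\Sigma_{theory}$) have interpretation sets, symbols of $\Sigma_{theory}$ have interpretations; values are constants of $\Sigma_{theory}$ in bijection with the interpretation set of their sort; $\Sigma_{terms}\cap\Sigma_{theory}$ contains only values. Logical terms are terms over $\Sigma_{theory}$; ground ones evaluate via $[\![\cdot]\!]$. A constraint is a logical term of sort $\mathsf{bool}$ (interpreted in $\{\top,\bot\}$); $\gamma$ respects $\varphi$ if $\gamma(x)$ is a value for $x\in\mathit{Var}(\varphi)$ and $[\![\varphi\gamma]\!]=\top$. A rule $\ell\to r\,[\varphi]$ has $\ell,r$ of equal sort, $\ell$ not a logical term; $\mathit{LVar}=\mathit{Var}(\varphi)\cup(\mathit{Var}(r)\setminus\mathit{Var}(\ell))$; $\gamma$ respects it if $\gamma(x)$ is a value for $x\in\mathit{LVar}$ and $[\![\varphi\gamma]\!]=\top$. $\mathcal{R}_{calc}=\{f(\vec x)\to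 y\,[y=f(\vec x)]\mid f\in\Sigma_{theory}$ not a value$\}$; $C[\ell\gamma]\to_{\mathcal{R}}C[r\gamma]$ if $\ell\to r[\varphi]\in\mathcal{R}\cup\mathcal{R}_{calc}$ and $\gamma$ respects it. Defined symbols are root symbols of left-hand sides of rules in $\mathcal{R}$; constructors are the other symbols of $\Sigma_{terms}$ and all values. Standing restrictions: (1) $\Sigma_{theory}$ contains $\wedge,\vee,\Rightarrow,\neg$ and $=_\iota,\neq_\iota$ for each theory sort with standard meaning; (2) $\to_{\mathcal{R}}$ is terminating; (3) every ground term is a ground constructor term or reduces by $\to_{\mathcal{R}}$; (4) every sort has a ground term. An equation $s\approx t\,[\varphi]$ consists of terms $s,t$ and a constraint $\varphi$. A substitution $\gamma$ respects it if $\gamma$ respects $\varphi$ and $\mathit{Var}(s)\cup\mathit{Var}(t)\subseteq\mathit{Dom}(\gamma)$; it is an inductive theorem of $\mathcal{R}$ if $s\gamma\leftrightarrow^*_{\mathcal{R}}t\gamma$ for every respecting $\gamma$ all of whose values $\gamma(x)$, $x\in\mathit{Dom}(\gamma)$, are ground constructor terms. For a set $\mathcal{E}$ of equations, $C[s\gamma]\leftrightarrow_{\mathcal{E}}C[t\gamma]$ whenever $s\approx t[\varphi]\in\mathcal{E}$ or $t\approx s[\varphi]\in\mathcal{E}$ and $\gamma$ respects $\varphi$. -}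

module Defs where

open import Data.Bool using (Bool; T)
open import Data.List using (List; []; _∷_)
open import Data.List.Relation.Unary.All using (All; []; _∷_)
open import Data.List.Membership.Propositional using (_∈_)
open import Data.Product using (Σ; _×_; _,_; proj₂)
open import Data.Unit using (⊤)
open import Data.Sum using (_⊎_)
open import Function using (_∘_; _⇔_)
open import Function.Definitions using (Bijective)
open import Relation.Nullary using (¬_)
open import Relation.Binary.PropositionalEquality using (_≡_; _≢_)
open import Relation.Binary.Construct.Closure.Equivalence using (EqClosure)
open import Induction.WellFounded using (WellFounded)

record Theory : Set₁ where
  field
    Sort : Set
    V    : Sort → Set
    Sym  : List Sort → Sort → Set
    inTerms inTheory isValue : ∀ {as s} → Sym as s → Bool
    cover         : ∀ {as s} (f : Sym as s) → T (inTerms f) ⊎ T (inTheory f)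
    value-const   : ∀ {as s} (f : Sym as s) → T (isValue f) → as ≡ []
    value-theory  : ∀ {as s} (f : Sym as s) → T (isValue f) → T (inTheory f)
    overlap-value : ∀ {as s} (f : Sym as s) →
                    T (inTerms f) → T (inTheory f) → T (isValue f)
    TSort         : Sort → Set
    theory-sorts  : ∀ {as s} (f : Sym as s) → T (inTheory f) → All TSort as × TSort s
    I             : Sort → Set
    ⟦_⟧           : ∀ {as s} (f : Sym as s) → T (inTheory f) → All I as → I s
    values-bij    : ∀ ι → TSort ι →
                    Bijective {A = Σ (Sym [] ι) (T ∘ isValue)} _≡_ _≡_
                      (λ { (v , p) → ⟦ v ⟧ (value-theory v p) [] })
    bool          : Sort
    bool-theory   : TSort bool
    ⊤ᵇ ⊥ᵇ         : I bool
    ⊤≢⊥           : ⊤ᵇ ≢ ⊥ᵇ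
    bool-cases    : ∀ (b : I bool) → b ≡ ⊤ᵇ ⊎ b ≡ ⊥ᵇ
    ∧ˢ ∨ˢ ⇒ˢ      : Sym (bool ∷ bool ∷ []) bool
    ¬ˢ            : Sym (bool ∷ []) bool
    ∧-th          : T (inTheory ∧ˢ)
    ∨-th          : T (inTheory ∨ˢ)
    ⇒-th          : T (inTheory ⇒ˢ)
    ¬-th          : T (inTheory ¬ˢ)
    ∧-sem : ∀ a b → (⟦ ∧ˢ ⟧ ∧-th (a ∷ b ∷ []) ≡ ⊤ᵇ) ⇔ (a ≡ ⊤ᵇ × b ≡ ⊤ᵇ)
    ∨-sem : ∀ a b → (⟦ ∨ˢ ⟧ ∨-th (a ∷ b ∷ []) ≡ ⊤ᵇ) ⇔ (a ≡ ⊤ᵇ ⊎ b ≡ ⊤ᵇ)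
    ⇒-sem : ∀ a b → (⟦ ⇒ˢ ⟧ ⇒-th (a ∷ b ∷ []) ≡ ⊤ᵇ) ⇔ (a ≡ ⊤ᵇ → b ≡ ⊤ᵇ)
    ¬-sem : ∀ a → (⟦ ¬ˢ ⟧ ¬-th (a ∷ []) ≡ ⊤ᵇ) ⇔ (a ≡ ⊥ᵇ)
    =ˢ ≠ˢ         : ∀ ι → TSort ι → Sym (ι ∷ ι ∷ []) bool
    =-th          : ∀ ι (p : TSort ι) → T (inTheory (=ˢ ι p))
    ≠-th          : ∀ ι (p : TSort ι) → T (inTheory (≠ˢ ι p))
    =-sem : ∀ ι (p : TSort ι) a b →
            (⟦ =ˢ ι p ⟧ (=-th ι p) (a ∷ b ∷ []) ≡ ⊤ᵇ) ⇔ (a ≡ b)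
    ≠-sem : ∀ ι (p : TSort ι) a b →
            (⟦ ≠ˢ ι p ⟧ (≠-th ι p) (a ∷ b ∷ []) ≡ ⊤ᵇ) ⇔ (a ≢ b)

module Over (L : Theory) where
  open Theory L public

  mutual
    data Term : Sort → Set where
      var : ∀ {s} → V s → Term s
      app : ∀ {as s} → Sym as s → Terms as → Term s

    data Terms : List Sort → Set where
      []  : Terms []
      _∷_ : ∀ {a as} → Term a → Terms as → Terms (a ∷ as)

  mutual
    data Occ {s} (x : V s) : ∀ {s'} → Term s' → Set where
      here : Occ x (var x)
      arg  : ∀ {as s'} {f : Sym as s'} {ts} → OccArgs x ts → Occ x (app f ts)

    data OccArgs {s} (x : V s) : ∀ {as} → Terms as → Set where
      hd : ∀ {a as} {t : Term a} {ts : Terms as} → Occ x t → OccArgs x (t ∷ ts)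
      tl : ∀ {a as} {t : Term a} {ts : Terms as} → OccArgs x ts → OccArgs x (t ∷ ts)

  Ground : ∀ {s} → Term s → Set
  Ground t = ∀ {s'} (x : V s') → ¬ Occ x t

  mutual
    data Logical : ∀ {s} → Term s → Set where
      var : ∀ {s} {x : V s} → Logical (var x)
      app : ∀ {as s} {f : Sym as s} {ts} → T (inTheory f) → LogicalArgs ts →
            Logical (app f ts)

    data LogicalArgs : ∀ {as} → Terms as → Set where
      []  : LogicalArgs []
      _∷_ : ∀ {a as} {t : Term a} {ts : Terms as} →
            Logical t → LogicalArgs ts → LogicalArgs (t ∷ ts)

  IsValue : ∀ {s} → Term s → Set
  IsValue {s} t = Σ (Sym [] s) λ v → T (isValue v) × t ≡ app v []

  mutual
    data Eval : ∀ {s} → Term s → I s → Set where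
      app : ∀ {as s} {f : Sym as s} {ts} {vs} (p : T (inTheory f)) →
            EvalArgs ts vs → Eval (app f ts) (⟦ f ⟧ p vs)

    data EvalArgs : ∀ {as} → Terms as → All I as → Set where
      []  : EvalArgs [] []
      _∷_ : ∀ {a as} {t : Term a} {ts : Terms as} {v vs} →
            Eval t v → EvalArgs ts vs → EvalArgs (t ∷ ts) (v ∷ vs)

  record Subst : Set where
    field
      σ       : ∀ {s} → V s → Term s
      support : List (Σ Sort V)
      finite  : ∀ {s} (x : V s) → ¬ ((s , x) ∈ support) → σ x ≡ var x
  open Subst public

  InDom : Subst → ∀ {s} → V s → Set
  InDom γ x = σ γ x ≢ var x

  mutual
    _⟨_⟩ : ∀ {s} → Term s → Subst → Term s
    var x    ⟨ γ ⟩ = σ γ x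
    app f ts ⟨ γ ⟩ = app f (ts ⟨ γ ⟩*)

    _⟨_⟩* : ∀ {as} → Terms as → Subst → Terms as
    []       ⟨ γ ⟩* = []
    (t ∷ ts) ⟨ γ ⟩* = (t ⟨ γ ⟩) ∷ (ts ⟨ γ ⟩*)

  module _ (Top : ∀ {s} → Term s → Term s → Set) where
    mutual
      data InCtx : ∀ {s} → Term s → Term s → Set where
        top : ∀ {s} {u v : Term s} → Top u v → InCtx u v
        arg : ∀ {as s} {f : Sym as s} {ts us} → InCtxArgs ts us →
              InCtx (app f ts) (app f us)

      data InCtxArgs : ∀ {as} → Terms as → Terms as → Set where
        hd : ∀ {a as} {t u : Term a} {ts : Terms as} → InCtx t u →
             InCtxArgs (t ∷ ts) (u ∷ ts)
        tl : ∀ {a as} {t : Term a} {ts us : Terms as} → InCtxArgs ts us →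
             InCtxArgs (t ∷ ts) (t ∷ us)

  AllValues : ∀ {as} → Terms as → Set
  AllValues []       = ⊤
  AllValues (t ∷ ts) = IsValue t × AllValues ts

  RespectsC : Subst → Term bool → Set
  RespectsC γ φ = (∀ {s} (x : V s) → Occ x φ → IsValue (σ γ x))
                × Eval (φ ⟨ γ ⟩) ⊤ᵇ

  record Rule : Set where
    field
      sort        : Sort
      lhs rhs     : Term sort
      cond        : Term bool
      cond-logical : Logical cond
      lhs-not-logical : ¬ Logical lhs
  open Rule public

  -- γ respects the rule (LVar = Var(φ) ∪ (Var(r) ∖ Var(ℓ)))
  RespectsR : Subst → Rule → Set
  RespectsR γ ρ =
    (∀ {s} (x : V s) → (Occ x (cond ρ) ⊎ (Occ x (rhs ρ) × ¬ Occ x (lhs ρ))) →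
       IsValue (σ γ x))
    × Eval (cond ρ ⟨ γ ⟩) ⊤ᵇ

  record Equation : Set where
    field
      esort       : Sort
      eleft eright : Term esort
      econd       : Term bool
      econd-logical : Logical econd
  open Equation public

  RespectsE : Subst → Equation → Set
  RespectsE γ e = RespectsC γ (econd e)
                × (∀ {s} (x : V s) → (Occ x (eleft e) ⊎ Occ x (eright e)) → InDom γ x)

  module Rules (R : Rule → Set) where

    data RootIs {s'} : Term s' → ∀ {as s} → Sym as s → Set where
      root : ∀ {as} {f : Sym as s'} {ts} → RootIs (app f ts) f

    Defined : ∀ {as s} → Sym as s → Set
    Defined f = Σ Rule λ ρ → R ρ × RootIs (lhs ρ) f

    Constructor : ∀ {as s} → Sym as s → Set
    Constructor f = (T (inTerms f) × ¬ Defined f) ⊎ T (isValue f)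

    mutual
      data GroundCon : ∀ {s} → Term s → Set where
        app : ∀ {as s} {f : Sym as s} {ts} → Constructor f → GroundConArgs ts →
              GroundCon (app f ts)

      data GroundConArgs : ∀ {as} → Terms as → Set where
        []  : GroundConArgs []
        _∷_ : ∀ {a as} {t : Term a} {ts : Terms as} →
              GroundCon t → GroundConArgs ts → GroundConArgs (t ∷ ts)

    data RootStep : ∀ {s} → Term s → Term s → Set where
      rule : (ρ : Rule) → R ρ → (γ : Subst) → RespectsR γ ρ →
             RootStep (lhs ρ ⟨ γ ⟩) (rhs ρ ⟨ γ ⟩)
      -- instance f(v₁,…,vₙ) → w of the R_calc rule f(x⃗) → y [y = f(x⃗)]
      -- under a respecting γ (γ(xᵢ) = vᵢ, γ(y) = w, all values, and
      -- [[ (y = f(x⃗)) γ ]] = ⊤)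
      calc : ∀ {as s} (f : Sym as s) (th : T (inTheory f)) → ¬ T (isValue f) →
             (vs : Terms as) → AllValues vs → (w : Term s) → IsValue w →
             Eval (app (=ˢ s (proj₂ (theory-sorts f th))) (w ∷ app f vs ∷ [])) ⊤ᵇ →
             RootStep (app f vs) w

    _⟶_ : ∀ {s} → Term s → Term s → Set
    _⟶_ = InCtx RootStep

    _↔*_ : ∀ {s} → Term s → Term s → Set
    _↔*_ = EqClosure _⟶_

    -- standing restrictions (2)–(4) ((1) is part of Theory)
    record Restrictions : Set where
      field
        terminating : ∀ s → WellFounded (λ (u t : Term s) → t ⟶ u)
        ground-progress : ∀ {s} (t : Term s) → Ground t →
                          GroundCon t ⊎ Σ (Term s) (λ u → t ⟶ u)
        inhabited : ∀ s → Σ (Term s) Ground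

    InductiveTheorem : Equation → Set
    InductiveTheorem e =
      (γ : Subst) → RespectsE γ e →
      (∀ {s} (x : V s) → InDom γ x → GroundCon (σ γ x)) →
      (eleft e ⟨ γ ⟩) ↔* (eright e ⟨ γ ⟩)

  module Eqns (E : Equation → Set) where
    data RootEStep : ∀ {s} → Term s → Term s → Set where
      fwd : (e : Equation) → E e → (γ : Subst) → RespectsC γ (econd e) →
            RootEStep (eleft e ⟨ γ ⟩) (eright e ⟨ γ ⟩)
      bwd : (e : Equation) → E e → (γ : Subst) → RespectsC γ (econd e) →
            RootEStep (eright e ⟨ γ ⟩) (eleft e ⟨ γ ⟩)

    _↔E_ : ∀ {s} → Term s → Term s → Set
    _↔E_ = InCtx RootEStep

-- (ii) ⇒ (i): an instance sγ ≈ tγ with ground constructor values on Dom(γ)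
-- is ground and is itself a root ↔_E step.
-- (i) ⇒ (ii): an ↔_E step between ground terms is a root step in a ground
-- context and ↔*_R is a congruence, so it suffices to treat a root step
-- sγ ↔_E tγ with sγ, tγ ground.  By termination and sufficient completeness every ground γ(x) is
-- ↔*_R-convertible to a ground constructor term; replacing γ(x) by it (but
-- keeping values, so that the constraint still holds) gives a substitution
-- γ' to which the inductive theorem applies, and sγ ↔* sγ' ↔* tγ' ↔* tγ.
module Submission where

open import Defs
open import Data.Empty using (⊥-elim)
open import Data.Product using (Σ; _×_; _,_; proj₁; proj₂)
open import Data.Sum using (_⊎_; inj₁; inj₂)
open import Function using (_⇔_)
open import Function.Bundles using (mk⇔)
open import Induction.WellFounded using (Acc; acc)
open import Relation.Binary.Construct.Closure.Equivalence
  using (EqClosure; gmap; symmetric)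
open import Relation.Binary.Construct.Closure.ReflexiveTransitive
  using (ε; _◅_; _◅◅_)
open import Relation.Binary.Construct.Closure.Symmetric using (fwd)
open import Relation.Binary.PropositionalEquality
  using (_≡_; _≢_; refl; sym; cong; cong₂; subst)
open import Relation.Nullary using (¬_; Dec; yes; no)
open import Relation.Nullary.Decidable.Core using (T?)

module Substitution (L : Theory) where
  open Over L

  Grounds : ∀ {as} → Terms as → Set
  Grounds ts = ∀ {s} (x : V s) → ¬ OccArgs x ts

  mutual
    Occ-⟨⟩ : ∀ {s s' s''} {x : V s} {y : V s'} (t : Term s'') (γ : Subst) →
             Occ x t → Occ y (σ γ x) → Occ y (t ⟨ γ ⟩)
    Occ-⟨⟩ (var _)    γ here     o = o
    Occ-⟨⟩ (app f ts) γ (arg os) o = arg (OccArgs-⟨⟩ ts γ os o)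

    OccArgs-⟨⟩ : ∀ {s s' as} {x : V s} {y : V s'} (ts : Terms as) (γ : Subst) →
                 OccArgs x ts → Occ y (σ γ x) → OccArgs y (ts ⟨ γ ⟩*)
    OccArgs-⟨⟩ (t ∷ ts) γ (hd o)  o' = hd (Occ-⟨⟩ t γ o o')
    OccArgs-⟨⟩ (t ∷ ts) γ (tl os) o' = tl (OccArgs-⟨⟩ ts γ os o')

  mutual
    Ground-⟨⟩ : ∀ {s'} (t : Term s') (γ : Subst) →
                (∀ {s} (x : V s) → Occ x t → Ground (σ γ x)) → Ground (t ⟨ γ ⟩)
    Ground-⟨⟩ (var x)    γ g = g x here
    Ground-⟨⟩ (app f ts) γ g y (arg o) = Grounds-⟨⟩ ts γ (λ x o' → g x (arg o')) y o

    Grounds-⟨⟩ : ∀ {as} (ts : Terms as) (γ : Subst) →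
                 (∀ {s} (x : V s) → OccArgs x ts → Ground (σ γ x)) → Grounds (ts ⟨ γ ⟩*)
    Grounds-⟨⟩ (t ∷ ts) γ g y (hd o) = Ground-⟨⟩ t γ (λ x o' → g x (hd o')) y o
    Grounds-⟨⟩ (t ∷ ts) γ g y (tl o) = Grounds-⟨⟩ ts γ (λ x o' → g x (tl o')) y o

  Ground-⟨⟩⁻¹ : ∀ {s s'} {x : V s} (t : Term s') (γ : Subst) →
                Ground (t ⟨ γ ⟩) → Occ x t → Ground (σ γ x)
  Ground-⟨⟩⁻¹ t γ g o y o' = g y (Occ-⟨⟩ t γ o o')

  mutual
    ⟨⟩-cong : ∀ {s'} (t : Term s') (γ δ : Subst) →
              (∀ {s} (x : V s) → Occ x t → σ γ x ≡ σ δ x) → t ⟨ γ ⟩ ≡ t ⟨ δ ⟩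
    ⟨⟩-cong (var x)    γ δ h = h x here
    ⟨⟩-cong (app f ts) γ δ h = cong (app f) (⟨⟩*-cong ts γ δ (λ x o → h x (arg o)))

    ⟨⟩*-cong : ∀ {as} (ts : Terms as) (γ δ : Subst) →
               (∀ {s} (x : V s) → OccArgs x ts → σ γ x ≡ σ δ x) → ts ⟨ γ ⟩* ≡ ts ⟨ δ ⟩*
    ⟨⟩*-cong []       γ δ h = refl
    ⟨⟩*-cong (t ∷ ts) γ δ h =
      cong₂ _∷_ (⟨⟩-cong t γ δ (λ x o → h x (hd o))) (⟨⟩*-cong ts γ δ (λ x o → h x (tl o)))

  value⇒ground : ∀ {s} {t : Term s} → IsValue t → Ground t
  value⇒ground (v , p , refl) x (arg ())

  mutual
    ground? : ∀ {s} (t : Term s) → Dec (Ground t)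
    ground? (var y) = no (λ g → g y here)
    ground? (app f ts) with grounds? ts
    ... | yes g = yes (λ { x (arg o) → g x o })
    ... | no ¬g = no (λ g → ¬g (λ x o → g x (arg o)))

    grounds? : ∀ {as} (ts : Terms as) → Dec (Grounds ts)
    grounds? [] = yes (λ x ())
    grounds? (t ∷ ts) with ground? t | grounds? ts
    ... | yes g | yes gs = yes (λ { x (hd o) → g x o ; x (tl o) → gs x o })
    ... | no ¬g | _      = no (λ gs → ¬g (λ x o → gs x (hd o)))
    ... | yes _ | no ¬gs = no (λ gs → ¬gs (λ x o → gs x (tl o)))

  value? : ∀ {s} (t : Term s) → Dec (IsValue t)
  value? (var y)          = no λ { (_ , _ , ()) }
  value? (app f (_ ∷ _))  = no λ { (_ , _ , ()) }
  value? (app f []) with T? (isValue f)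
  ... | yes p = yes (f , p , refl)
  ... | no ¬p = no λ { (_ , p , refl) → ¬p p }

module Rewriting (L : Theory) (R : Over.Rule L → Set) where
  open Over L
  open Rules R
  open Substitution L

  mutual
    GroundCon⇒Ground : ∀ {s} {t : Term s} → GroundCon t → Ground t
    GroundCon⇒Ground (app _ gs) x (arg o) = GroundConArgs⇒Grounds gs x o

    GroundConArgs⇒Grounds : ∀ {as} {ts : Terms as} → GroundConArgs ts → Grounds ts
    GroundConArgs⇒Grounds (g ∷ gs) x (hd o) = GroundCon⇒Ground g x o
    GroundConArgs⇒Grounds (g ∷ gs) x (tl o) = GroundConArgs⇒Grounds gs x o

  _↔*ᵃ_ : ∀ {as} → Terms as → Terms as → Set
  _↔*ᵃ_ = EqClosure (InCtxArgs RootStep)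

  ↔*-hd : ∀ {a as} {t u : Term a} {ts : Terms as} → t ↔* u → (t ∷ ts) ↔*ᵃ (u ∷ ts)
  ↔*-hd {ts = ts} = gmap (_∷ ts) hd

  ↔*ᵃ-tl : ∀ {a as} {t : Term a} {ts us : Terms as} → ts ↔*ᵃ us → (t ∷ ts) ↔*ᵃ (t ∷ us)
  ↔*ᵃ-tl {t = t} = gmap (t ∷_) tl

  ↔*-app : ∀ {as s} {f : Sym as s} {ts us} → ts ↔*ᵃ us → app f ts ↔* app f us
  ↔*-app {f = f} = gmap (app f) arg

  mutual
    ⟨⟩-cong-↔* : ∀ {s'} (t : Term s') (γ δ : Subst) →
                 (∀ {s} (x : V s) → Occ x t → σ γ x ↔* σ δ x) → (t ⟨ γ ⟩) ↔* (t ⟨ δ ⟩)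
    ⟨⟩-cong-↔* (var x)    γ δ h = h x here
    ⟨⟩-cong-↔* (app f ts) γ δ h = ↔*-app (⟨⟩*-cong-↔* ts γ δ (λ x o → h x (arg o)))

    ⟨⟩*-cong-↔* : ∀ {as} (ts : Terms as) (γ δ : Subst) →
                  (∀ {s} (x : V s) → OccArgs x ts → σ γ x ↔* σ δ x) →
                  (ts ⟨ γ ⟩*) ↔*ᵃ (ts ⟨ δ ⟩*)
    ⟨⟩*-cong-↔* []       γ δ h = ε
    ⟨⟩*-cong-↔* (t ∷ ts) γ δ h =
      ↔*-hd (⟨⟩-cong-↔* t γ δ (λ x o → h x (hd o)))
        ◅◅ ↔*ᵃ-tl (⟨⟩*-cong-↔* ts γ δ (λ x o → h x (tl o)))

  -- A variable of r that is not in ℓ belongs to LVar, hence is instantiated by a value.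
  RootStep-Ground : ∀ {s} {t u : Term s} → RootStep t u → Ground t → Ground u
  RootStep-Ground (rule ρ _ γ (lvar-values , _)) g =
    Ground-⟨⟩ (rhs ρ) γ λ x o y o' →
      value⇒ground (lvar-values x (inj₂ (o , λ o'' → g y (Occ-⟨⟩ (lhs ρ) γ o'' o')))) y o'
  RootStep-Ground (calc _ _ _ _ _ _ w-value _) _ = value⇒ground w-value

  mutual
    ⟶-Ground : ∀ {s} {t u : Term s} → t ⟶ u → Ground t → Ground u
    ⟶-Ground (top st) g = RootStep-Ground st g
    ⟶-Ground (arg st) g x (arg o) = ⟶ᵃ-Grounds st (λ y o' → g y (arg o')) x o

    ⟶ᵃ-Grounds : ∀ {as} {ts us : Terms as} → InCtxArgs RootStep ts us →
                 Grounds ts → Grounds us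
    ⟶ᵃ-Grounds (hd st) g x (hd o) = ⟶-Ground st (λ y o' → g y (hd o')) x o
    ⟶ᵃ-Grounds (hd st) g x (tl o) = g x (tl o)
    ⟶ᵃ-Grounds (tl st) g x (hd o) = g x (hd o)
    ⟶ᵃ-Grounds (tl st) g x (tl o) = ⟶ᵃ-Grounds st (λ y o' → g y (tl o')) x o

  module _ {Top : ∀ {s} → Term s → Term s → Set}
           (root-instance : ∀ {s} {u v : Term s} → Ground u → Ground v → Top u v → u ↔* v) where
    mutual
      InCtx-ground⇒↔* : ∀ {s} {u v : Term s} → Ground u → Ground v → InCtx Top u v → u ↔* v
      InCtx-ground⇒↔* gu gv (top st) = root-instance gu gv st
      InCtx-ground⇒↔* gu gv (arg st) =
        ↔*-app (InCtxArgs-ground⇒↔* (λ x o → gu x (arg o)) (λ x o → gv x (arg o)) st)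

      InCtxArgs-ground⇒↔* : ∀ {as} {ts us : Terms as} → Grounds ts → Grounds us →
                            InCtxArgs Top ts us → ts ↔*ᵃ us
      InCtxArgs-ground⇒↔* gts gus (hd st) =
        ↔*-hd (InCtx-ground⇒↔* (λ x o → gts x (hd o)) (λ x o → gus x (hd o)) st)
      InCtxArgs-ground⇒↔* gts gus (tl st) =
        ↔*ᵃ-tl (InCtxArgs-ground⇒↔* (λ x o → gts x (tl o)) (λ x o → gus x (tl o)) st)

  GroundConInstance : Subst → Set
  GroundConInstance γ = ∀ {s} (x : V s) → InDom γ x → GroundCon (σ γ x)

  GroundConInstance-Ground : ∀ {s'} (t : Term s') (γ : Subst) → GroundConInstance γ →
                             (∀ {s} (x : V s) → Occ x t → InDom γ x) → Ground (t ⟨ γ ⟩)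
  GroundConInstance-Ground t γ gc dom =
    Ground-⟨⟩ t γ (λ x o → GroundCon⇒Ground (gc x (dom x o)))

module Normalisation (L : Theory) (R : Over.Rule L → Set) (rs : Over.Rules.Restrictions L R) where
  open Over L
  open Rules R
  open Rules.Restrictions rs
  open Substitution L
  open Rewriting L R

  GroundConForm : ∀ {s} → Term s → Set
  GroundConForm {s} t = Σ (Term s) λ n → GroundCon n × (t ↔* n)

  ground⇒GroundConForm : ∀ {s} {t : Term s} → Ground t → GroundConForm t
  ground⇒GroundConForm {s} {t} = go t (terminating s t)
    where
    go : (t : Term s) → Acc (λ u t → t ⟶ u) t → Ground t → GroundConForm t
    go t (acc rec) g with ground-progress t g
    ... | inj₁ gc       = t , gc , ε
    ... | inj₂ (u , st) with go u (rec st) (⟶-Ground st g)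
    ...   | n , gc , u↔n = n , gc , (fwd st ◅ u↔n)

  data Kind {s} (t : Term s) : Set where
    value     : IsValue t → Kind t
    ground    : ¬ IsValue t → Ground t → Kind t
    nonground : ¬ Ground t → Kind t

  kind : ∀ {s} (t : Term s) → Kind t
  kind t with value? t | ground? t
  ... | yes v | _      = value v
  ... | no ¬v | yes g  = ground ¬v g
  ... | no _  | no ¬g  = nonground ¬g

  -- The replacement for γ(x): values are kept (constraints must still hold),
  -- other ground terms become a ground constructor form, and non-ground
  -- terms are dropped from the domain (they never occur in a ground instance).
  represent : ∀ {s} (t : Term s) → V s → Kind t → Term s
  represent t x (value _)      = t
  represent t x (ground _ g)   = proj₁ (ground⇒GroundConForm g)
  represent t x (nonground _)  = var x

  represent-value : ∀ {s} {t : Term s} {x : V s} (k : Kind t) → IsValue t → represent t x k ≡ t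
  represent-value (value _)      v = refl
  represent-value (ground ¬v _)  v = ⊥-elim (¬v v)
  represent-value (nonground ¬g) v = ⊥-elim (¬g (value⇒ground v))

  represent-↔* : ∀ {s} {t : Term s} {x : V s} (k : Kind t) → Ground t → t ↔* represent t x k
  represent-↔* (value _)      _ = ε
  represent-↔* (ground _ g)   _ = proj₂ (proj₂ (ground⇒GroundConForm g))
  represent-↔* (nonground ¬g) g = ⊥-elim (¬g g)

  represent-InDom : ∀ {s} {t : Term s} {x : V s} (k : Kind t) → Ground t → represent t x k ≢ var x
  represent-InDom (value (_ , _ , refl)) _ ()
  represent-InDom (ground _ g) _ eq with ground⇒GroundConForm g
  represent-InDom (ground _ g) _ refl | _ , () , _
  represent-InDom (nonground ¬g) g = ⊥-elim (¬g g)

  represent-GroundCon : ∀ {s} {t : Term s} {x : V s} (k : Kind t) →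
                        represent t x k ≢ var x → GroundCon (represent t x k)
  represent-GroundCon (value (_ , p , refl)) _ = app (inj₂ p) []
  represent-GroundCon (ground _ g)           _ = proj₁ (proj₂ (ground⇒GroundConForm g))
  represent-GroundCon (nonground _)         ¬x = ⊥-elim (¬x refl)

  normalise : Subst → Subst
  normalise γ = record
    { σ       = λ x → represent (σ γ x) x (kind (σ γ x))
    ; support = support γ
    ; finite  = λ x x∉ → cong (λ t → represent t x (kind t)) (finite γ x x∉)
    }

  normalise-GroundConInstance : ∀ γ → GroundConInstance (normalise γ)
  normalise-GroundConInstance γ x = represent-GroundCon (kind (σ γ x))

  normalise-RespectsC : ∀ γ φ → RespectsC γ φ → RespectsC (normalise γ) φ
  normalise-RespectsC γ φ (values , eval) =
    (λ x o → subst IsValue (sym (kept x o)) (values x o))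
    , subst (λ t → Eval t ⊤ᵇ) (⟨⟩-cong φ γ (normalise γ) (λ x o → sym (kept x o))) eval
    where
    kept : ∀ {s} (x : V s) → Occ x φ → σ (normalise γ) x ≡ σ γ x
    kept x o = represent-value (kind (σ γ x)) (values x o)

  normalise-InDom : ∀ γ {s} (x : V s) → Ground (σ γ x) → InDom (normalise γ) x
  normalise-InDom γ x = represent-InDom (kind (σ γ x))

  ⟨⟩-normalise-↔* : ∀ {s} (t : Term s) γ → Ground (t ⟨ γ ⟩) → (t ⟨ γ ⟩) ↔* (t ⟨ normalise γ ⟩)
  ⟨⟩-normalise-↔* t γ g =
    ⟨⟩-cong-↔* t γ (normalise γ) (λ x o → represent-↔* (kind (σ γ x)) (Ground-⟨⟩⁻¹ t γ g o))

  InductiveTheorem-ground-instance :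
    (e : Equation) → InductiveTheorem e → (γ : Subst) → RespectsC γ (econd e) →
    Ground (eleft e ⟨ γ ⟩) → Ground (eright e ⟨ γ ⟩) → (eleft e ⟨ γ ⟩) ↔* (eright e ⟨ γ ⟩)
  InductiveTheorem-ground-instance e it γ resp gl gr =
    ⟨⟩-normalise-↔* (eleft e) γ gl
      ◅◅ it (normalise γ) (normalise-RespectsC γ (econd e) resp , dom)
            (normalise-GroundConInstance γ)
      ◅◅ symmetric _ (⟨⟩-normalise-↔* (eright e) γ gr)
    where
    dom : ∀ {s} (x : V s) → Occ x (eleft e) ⊎ Occ x (eright e) → InDom (normalise γ) x
    dom x (inj₁ o) = normalise-InDom γ x (Ground-⟨⟩⁻¹ (eleft e) γ gl o)
    dom x (inj₂ o) = normalise-InDom γ x (Ground-⟨⟩⁻¹ (eright e) γ gr o)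

lemma4p3 : (L : Theory) → let open Over L in
    (R : Rule → Set) → Rules.Restrictions R →
    (E : Equation → Set) →
    ((e : Equation) → E e → Rules.InductiveTheorem R e)
      ⇔ (∀ {s} (u v : Term s) → Ground u → Ground v →
           Eqns._↔E_ E u v → Rules._↔*_ R u v)
lemma4p3 L R rs E = mk⇔ theorems⇒ground-convertible ground-convertible⇒theorems
  where
  open Over L
  open Rules R
  open Eqns E
  open Rewriting L R
  open Normalisation L R rs

  theorems⇒ground-convertible : ((e : Equation) → E e → InductiveTheorem e) →
    ∀ {s} (u v : Term s) → Ground u → Ground v → u ↔E v → u ↔* v
  theorems⇒ground-convertible its _ _ = InCtx-ground⇒↔* root-instance
    where
    root-instance : ∀ {s} {u v : Term s} → Ground u → Ground v → RootEStep u v → u ↔* v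
    root-instance gu gv (fwd e Ee γ resp) = InductiveTheorem-ground-instance e (its e Ee) γ resp gu gv
    root-instance gu gv (bwd e Ee γ resp) =
      symmetric _ (InductiveTheorem-ground-instance e (its e Ee) γ resp gv gu)

  ground-convertible⇒theorems : (∀ {s} (u v : Term s) → Ground u → Ground v → u ↔E v → u ↔* v) →
    (e : Equation) → E e → InductiveTheorem e
  ground-convertible⇒theorems conv e Ee γ (resp , dom) gc =
    conv _ _ (GroundConInstance-Ground (eleft e) γ gc (λ x o → dom x (inj₁ o)))
             (GroundConInstance-Ground (eright e) γ gc (λ x o → dom x (inj₂ o)))
             (top (fwd e Ee γ resp))
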